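{- Let $t\ge 1$ and let $g_1,\dots,g_5$ be five distinct nonzero elements of $\mathbb{Z}_2^t$. Then the Cayley graph $G=Cay(\mathbb{Z}_2^t;\{g_1,\dots,g_5\})$ has an internal partition.
   Context: $Cay(K;S)$ for an additive group $K$ and $S\subseteq K\setminus\{0\}$ with $S=-S$ has vertex set $K$ and $x\sim y$ iff $y-x\in S$. An internal partition of a graph is a partition of the vertex set into two nonempty sets such that every vertex has at least as many neighbours in its own class as in the other class. -}

module Defs where

open import Data.Bool using (Bool; true; false; _xor_; _∧_; not)
open import Data.Bool.Properties using () renaming (_≟_ to _≟B_)
open import Data.Nat using (ℕ; zero; suc; _≤_)
open import Data.Vec using (Vec; []; _∷_; zipWith)
open import Data.Vec.Properties using (≡-dec)
open import Data.List using (List; []; _∷_; _++_; map; filter; length)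
open import Data.Product using (Σ; ∃; _×_; _,_)
open import Relation.Binary.PropositionalEquality using (_≡_)
open import Relation.Nullary using (Dec; yes; no; ¬_)
open import Relation.Nullary.Decidable using (⌊_⌋)

Z2^ : ℕ → Set
Z2^ t = Vec Bool t

_⊕_ : ∀ {t} → Z2^ t → Z2^ t → Z2^ t
_⊕_ = zipWith _xor_

⊖_ : ∀ {t} → Z2^ t → Z2^ t
⊖ x = x

_-ᵥ_ : ∀ {t} → Z2^ t → Z2^ t → Z2^ t
y -ᵥ x = y ⊕ (⊖ x)

0ᵥ : ∀ {t} → Z2^ t
0ᵥ {zero} = []
0ᵥ {suc t} = false ∷ 0ᵥ

_≟ᵥ_ : ∀ {t} (x y : Z2^ t) → Dec (x ≡ y)
_≟ᵥ_ = ≡-dec _≟B_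

allZ2^ : (t : ℕ) → List (Z2^ t)
allZ2^ zero = [] ∷ []
allZ2^ (suc t) = map (false ∷_) (allZ2^ t) ++ map (true ∷_) (allZ2^ t)

_∈ᵇ_ : ∀ {t} → Z2^ t → List (Z2^ t) → Bool
x ∈ᵇ [] = false
x ∈ᵇ (s ∷ S) with x ≟ᵥ s
... | yes _ = true
... | no _ = x ∈ᵇ S

CayAdj : ∀ {t} → List (Z2^ t) → Z2^ t → Z2^ t → Bool
CayAdj S x y = (y -ᵥ x) ∈ᵇ S

countᵇ : ∀ {A : Set} → (A → Bool) → List A → ℕ
countᵇ p [] = 0
countᵇ p (a ∷ as) with p a
... | true = suc (countᵇ p as)
... | false = countᵇ p as

-- A partition of the vertex set into two classes, given by a 2-colouring
-- c; the class of x is { y | c y ≡ c x }.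
-- number of neighbours of x (in Cay(Z_2^t; S)) lying in x's own class
ownNbrs : ∀ {t} → List (Z2^ t) → (Z2^ t → Bool) → Z2^ t → ℕ
ownNbrs {t} S c x = countᵇ (λ y → CayAdj S x y ∧ ⌊ c y ≟B c x ⌋) (allZ2^ t)

otherNbrs : ∀ {t} → List (Z2^ t) → (Z2^ t → Bool) → Z2^ t → ℕ
otherNbrs {t} S c x = countᵇ (λ y → CayAdj S x y ∧ not ⌊ c y ≟B c x ⌋) (allZ2^ t)

IsInternalPartition : ∀ {t} → List (Z2^ t) → (Z2^ t → Bool) → Set
IsInternalPartition {t} S c =
  (∃ λ (a : Z2^ t) → c a ≡ true) × (∃ λ (b : Z2^ t) → c b ≡ false) ×
  (∀ (x : Z2^ t) → otherNbrs S c x ≤ ownNbrs S c x)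

HasInternalPartition : ∀ {t} → List (Z2^ t) → Set
HasInternalPartition {t} S = ∃ λ (c : Z2^ t → Bool) → IsInternalPartition S c

-- Colour ℤ₂ᵗ by membership in a proper subgroup H.  Translation by x is an
-- automorphism of the Cayley graph moving 0 to x, and a generator s ∈ H never
-- leaves the class of x, so every vertex has at least |S ∩ H| neighbours in
-- its own class and at most |S ∖ H| in the other.  It therefore suffices to
-- find a proper subgroup containing three of the five generators.  The span
-- of g₁, g₂, g₃ does, unless it contains g₄ and g₅ as well; then one of g₄, g₅
-- differs from g₁ + g₂ + g₃ and so is a sum gᵢ + gⱼ of two of g₁, g₂, g₃, and
-- the subgroup {0, gᵢ, gⱼ, gᵢ + gⱼ} contains three generators but not gₖ.
module Submission where

open import Defs
open import Data.Bool using (Bool; true; false; not; _∧_; _∨_)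
open import Data.Bool.Properties
  using (xor-comm; xor-assoc; xor-same; xor-identityʳ; ∨-identityʳ) renaming (_≟_ to _≟B_)
open import Data.Empty using (⊥-elim)
open import Data.List using (List; []; _∷_; _++_; map; length)
open import Data.List.Membership.Propositional using (_∈_; _∉_)
open import Data.List.Membership.Propositional.Properties
  using (∈-++⁺ˡ; ∈-++⁺ʳ; ∈-++⁻; ∈-map⁺; ∈-map⁻)
open import Data.List.Relation.Unary.All using (All; []; _∷_; lookup)
open import Data.List.Relation.Unary.All.Properties using (All¬⇒¬Any)
open import Data.List.Relation.Unary.Any using (here; there; any?)
open import Data.List.Relation.Unary.Unique.Propositional using (Unique; []; _∷_)
open import Data.Nat using (ℕ; suc; _+_; _≤_; _≥_; z≤n; s≤s)
open import Data.Nat.Properties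
  using (+-identityʳ; +-comm; +-suc; m≤n⇒m≤1+n; n≤1+n; +-cancelʳ-≤; +-mono-≤; module ≤-Reasoning)
open import Data.Product using (_,_)
open import Data.Sum using (_⊎_; inj₁; inj₂)
open import Data.Vec using ([]; _∷_)
open import Data.Vec.Properties using (zipWith-comm; zipWith-assoc)
open import Function using (_∘_)
open import Relation.Binary.PropositionalEquality
  using (_≡_; _≢_; _≗_; refl; sym; trans; cong; cong₂; subst; ≢-sym; module ≡-Reasoning)
open import Relation.Nullary using (Dec; yes; no)
open import Relation.Nullary.Decidable using (⌊_⌋; isYes≗does; dec-true)

⊕-comm : ∀ {t} (x y : Z2^ t) → x ⊕ y ≡ y ⊕ x
⊕-comm = zipWith-comm xor-comm

⊕-assoc : ∀ {t} (x y z : Z2^ t) → (x ⊕ y) ⊕ z ≡ x ⊕ (y ⊕ z)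
⊕-assoc = zipWith-assoc xor-assoc

⊕-identityʳ : ∀ {t} (x : Z2^ t) → x ⊕ 0ᵥ ≡ x
⊕-identityʳ [] = refl
⊕-identityʳ (b ∷ x) = cong₂ _∷_ (xor-identityʳ b) (⊕-identityʳ x)

⊕-self : ∀ {t} (x : Z2^ t) → x ⊕ x ≡ 0ᵥ
⊕-self [] = refl
⊕-self (b ∷ x) = cong₂ _∷_ (xor-same b) (⊕-self x)

module _ {t : ℕ} where
  open ≡-Reasoning

  x⊕[x⊕y]≡y : (x y : Z2^ t) → x ⊕ (x ⊕ y) ≡ y
  x⊕[x⊕y]≡y x y = begin
    x ⊕ (x ⊕ y)  ≡⟨ ⊕-assoc x x y ⟨
    (x ⊕ x) ⊕ y  ≡⟨ cong (_⊕ y) (⊕-self x) ⟩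
    0ᵥ ⊕ y       ≡⟨ ⊕-comm 0ᵥ y ⟩
    y ⊕ 0ᵥ       ≡⟨ ⊕-identityʳ y ⟩
    y            ∎

  [x⊕y]⊕y≡x : (x y : Z2^ t) → (x ⊕ y) ⊕ y ≡ x
  [x⊕y]⊕y≡x x y = trans (⊕-comm (x ⊕ y) y) (trans (cong (y ⊕_) (⊕-comm x y)) (x⊕[x⊕y]≡y y x))

  [x⊕y]⊕x≡y : (x y : Z2^ t) → (x ⊕ y) ⊕ x ≡ y
  [x⊕y]⊕x≡y x y = trans (⊕-comm (x ⊕ y) x) (x⊕[x⊕y]≡y x y)

  x⊕[y⊕z]≡y⊕[x⊕z] : (x y z : Z2^ t) → x ⊕ (y ⊕ z) ≡ y ⊕ (x ⊕ z)
  x⊕[y⊕z]≡y⊕[x⊕z] x y z = begin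
    x ⊕ (y ⊕ z)  ≡⟨ ⊕-assoc x y z ⟨
    (x ⊕ y) ⊕ z  ≡⟨ cong (_⊕ z) (⊕-comm x y) ⟩
    (y ⊕ x) ⊕ z  ≡⟨ ⊕-assoc y x z ⟩
    y ⊕ (x ⊕ z)  ∎

  [x⊕y]⊕[x⊕z]≡y⊕z : (x y z : Z2^ t) → (x ⊕ y) ⊕ (x ⊕ z) ≡ y ⊕ z
  [x⊕y]⊕[x⊕z]≡y⊕z x y z = begin
    (x ⊕ y) ⊕ (x ⊕ z)  ≡⟨ ⊕-assoc x y (x ⊕ z) ⟩
    x ⊕ (y ⊕ (x ⊕ z))  ≡⟨ cong (x ⊕_) (x⊕[y⊕z]≡y⊕[x⊕z] y x z) ⟩
    x ⊕ (x ⊕ (y ⊕ z))  ≡⟨ x⊕[x⊕y]≡y x (y ⊕ z) ⟩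
    y ⊕ z              ∎

module _ {A : Set} where

  countᵇ-++ : (p : A → Bool) (xs ys : List A) → countᵇ p (xs ++ ys) ≡ countᵇ p xs + countᵇ p ys
  countᵇ-++ p [] ys = refl
  countᵇ-++ p (x ∷ xs) ys with p x
  ... | true  = cong suc (countᵇ-++ p xs ys)
  ... | false = countᵇ-++ p xs ys

  countᵇ-map : ∀ {B : Set} (p : A → Bool) (f : B → A) (xs : List B) →
               countᵇ p (map f xs) ≡ countᵇ (λ x → p (f x)) xs
  countᵇ-map p f [] = refl
  countᵇ-map p f (x ∷ xs) with p (f x)
  ... | true  = cong suc (countᵇ-map p f xs)
  ... | false = countᵇ-map p f xs

  countᵇ-cong : {p q : A → Bool} → p ≗ q → (xs : List A) → countᵇ p xs ≡ countᵇ q xs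
  countᵇ-cong p≗q [] = refl
  countᵇ-cong {p} {q} p≗q (x ∷ xs) with p x | q x | p≗q x
  ... | true  | true  | _ = cong suc (countᵇ-cong p≗q xs)
  ... | false | false | _ = countᵇ-cong p≗q xs

  countᵇ-mono : {p q : A → Bool} → (∀ x → p x ≡ true → q x ≡ true) →
                (xs : List A) → countᵇ p xs ≤ countᵇ q xs
  countᵇ-mono p⇒q [] = z≤n
  countᵇ-mono {p} {q} p⇒q (x ∷ xs) with p x in px | q x in qx
  ... | true  | true  = s≤s (countᵇ-mono p⇒q xs)
  ... | false | true  = m≤n⇒m≤1+n (countᵇ-mono p⇒q xs)
  ... | false | false = countᵇ-mono p⇒q xs
  ... | true  | false with () ← trans (sym (p⇒q x px)) qx

  countᵇ-∨ : {p q : A → Bool} → (∀ x → p x ≡ true → q x ≡ false) → (xs : List A) →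
             countᵇ (λ x → p x ∨ q x) xs ≡ countᵇ p xs + countᵇ q xs
  countᵇ-∨ disjoint [] = refl
  countᵇ-∨ {p} {q} disjoint (x ∷ xs) with p x in px | q x in qx
  ... | true  | false = cong suc (countᵇ-∨ disjoint xs)
  ... | false | true  = trans (cong suc (countᵇ-∨ disjoint xs)) (sym (+-suc (countᵇ p xs) (countᵇ q xs)))
  ... | false | false = countᵇ-∨ disjoint xs
  ... | true  | true with () ← trans (sym (disjoint x px)) qx

  countᵇ-false : (xs : List A) → countᵇ (λ _ → false) xs ≡ 0
  countᵇ-false [] = refl
  countᵇ-false (x ∷ xs) = countᵇ-false xs

  countᵇ-true : (xs : List A) → countᵇ (λ _ → true) xs ≡ length xs
  countᵇ-true [] = refl
  countᵇ-true (x ∷ xs) = cong suc (countᵇ-true xs)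

  countᵇ-not : (p : A → Bool) (xs : List A) → countᵇ (λ x → not (p x)) xs + countᵇ p xs ≡ length xs
  countᵇ-not p [] = refl
  countᵇ-not p (x ∷ xs) with p x
  ... | true  = trans (+-suc _ (countᵇ p xs)) (cong suc (countᵇ-not p xs))
  ... | false = cong suc (countᵇ-not p xs)

∈ᵇ⇒∈ : ∀ {t} {x : Z2^ t} (S : List (Z2^ t)) → x ∈ᵇ S ≡ true → x ∈ S
∈ᵇ⇒∈ {x = x} (s ∷ S) x∈S with x ≟ᵥ s
... | yes x≡s = here x≡s
... | no _    = there (∈ᵇ⇒∈ S x∈S)

∈⇒∈ᵇ : ∀ {t} {x : Z2^ t} {S : List (Z2^ t)} → x ∈ S → x ∈ᵇ S ≡ true
∈⇒∈ᵇ {x = x} {s ∷ S} x∈S with x ≟ᵥ s | x∈S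
... | yes _   | _           = refl
... | no x≢s  | here x≡s    = ⊥-elim (x≢s x≡s)
... | no _    | there x∈S′  = ∈⇒∈ᵇ x∈S′

∉⇒∈ᵇ≡false : ∀ {t} {x : Z2^ t} {S : List (Z2^ t)} → x ∉ S → x ∈ᵇ S ≡ false
∉⇒∈ᵇ≡false {x = x} {S} x∉S with x ∈ᵇ S in x∈ᵇS
... | true  = ⊥-elim (x∉S (∈ᵇ⇒∈ S x∈ᵇS))
... | false = refl

#_ : ∀ {t} → (Z2^ t → Bool) → ℕ
# p = countᵇ p (allZ2^ _)

#-suc : ∀ {t} (p : Z2^ (suc t) → Bool) → # p ≡ # (λ x → p (false ∷ x)) + # (λ x → p (true ∷ x))
#-suc {t} p = trans (countᵇ-++ p (map (false ∷_) G) (map (true ∷_) G))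
                    (cong₂ _+_ (countᵇ-map p (false ∷_) G) (countᵇ-map p (true ∷_) G))
  where
  G : List (Z2^ t)
  G = allZ2^ t

#-translate : ∀ {t} (p : Z2^ t → Bool) (x : Z2^ t) → # (λ s → p (x ⊕ s)) ≡ # p
#-translate p [] = countᵇ-cong {p = λ s → p ([] ⊕ s)} {q = p} (λ { [] → refl }) (allZ2^ 0)
#-translate p (false ∷ x) = begin
  # (λ s → p ((false ∷ x) ⊕ s))                                  ≡⟨ #-suc (λ s → p ((false ∷ x) ⊕ s)) ⟩
  # (λ s → p (false ∷ (x ⊕ s))) + # (λ s → p (true ∷ (x ⊕ s)))  ≡⟨ cong₂ _+_ (#-translate (λ s → p (false ∷ s)) x) (#-translate (λ s → p (true ∷ s)) x) ⟩
  # (λ s → p (false ∷ s)) + # (λ s → p (true ∷ s))              ≡⟨ #-suc p ⟨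
  # p                                                            ∎
  where open ≡-Reasoning
#-translate p (true ∷ x) = begin
  # (λ s → p ((true ∷ x) ⊕ s))                                   ≡⟨ #-suc (λ s → p ((true ∷ x) ⊕ s)) ⟩
  # (λ s → p (true ∷ (x ⊕ s))) + # (λ s → p (false ∷ (x ⊕ s)))  ≡⟨ cong₂ _+_ (#-translate (λ s → p (true ∷ s)) x) (#-translate (λ s → p (false ∷ s)) x) ⟩
  # (λ s → p (true ∷ s)) + # (λ s → p (false ∷ s))              ≡⟨ +-comm (# (λ s → p (true ∷ s))) _ ⟩
  # (λ s → p (false ∷ s)) + # (λ s → p (true ∷ s))              ≡⟨ #-suc p ⟨
  # p                                                            ∎
  where open ≡-Reasoning

⌊∷≟ᵥ∷⌋ : ∀ {t} (b c : Bool) (s g : Z2^ t) → ⌊ (b ∷ s) ≟ᵥ (c ∷ g) ⌋ ≡ ⌊ b ≟B c ⌋ ∧ ⌊ s ≟ᵥ g ⌋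
⌊∷≟ᵥ∷⌋ b c s g = trans (isYes≗does ((b ∷ s) ≟ᵥ (c ∷ g)))
  (sym (cong₂ _∧_ (isYes≗does (b ≟B c)) (isYes≗does (s ≟ᵥ g))))

#-≟ᵥ∷ : ∀ {t} (q : Z2^ (suc t) → Bool) (b : Bool) (g : Z2^ t) →
        # (λ s → ⌊ s ≟ᵥ (b ∷ g) ⌋ ∧ q s) ≡ # (λ s → ⌊ s ≟ᵥ g ⌋ ∧ q (b ∷ s))
#-≟ᵥ∷ {t} q b g = begin
  # (λ s → ⌊ s ≟ᵥ (b ∷ g) ⌋ ∧ q s)
    ≡⟨ #-suc (λ s → ⌊ s ≟ᵥ (b ∷ g) ⌋ ∧ q s) ⟩
  # (λ s → ⌊ (false ∷ s) ≟ᵥ (b ∷ g) ⌋ ∧ q (false ∷ s)) + # (λ s → ⌊ (true ∷ s) ≟ᵥ (b ∷ g) ⌋ ∧ q (true ∷ s))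
    ≡⟨ cong₂ _+_ (countᵇ-cong (byHead false) G) (countᵇ-cong (byHead true) G) ⟩
  # (λ s → (⌊ false ≟B b ⌋ ∧ ⌊ s ≟ᵥ g ⌋) ∧ q (false ∷ s)) + # (λ s → (⌊ true ≟B b ⌋ ∧ ⌊ s ≟ᵥ g ⌋) ∧ q (true ∷ s))
    ≡⟨ onlyHead b ⟩
  # (λ s → ⌊ s ≟ᵥ g ⌋ ∧ q (b ∷ s))
    ∎
  where
  open ≡-Reasoning
  G : List (Z2^ t)
  G = allZ2^ t
  byHead : ∀ c s → ⌊ (c ∷ s) ≟ᵥ (b ∷ g) ⌋ ∧ q (c ∷ s) ≡ (⌊ c ≟B b ⌋ ∧ ⌊ s ≟ᵥ g ⌋) ∧ q (c ∷ s)
  byHead c s = cong (_∧ q (c ∷ s)) (⌊∷≟ᵥ∷⌋ c b s g)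
  onlyHead : ∀ b → # (λ s → (⌊ false ≟B b ⌋ ∧ ⌊ s ≟ᵥ g ⌋) ∧ q (false ∷ s))
                   + # (λ s → (⌊ true ≟B b ⌋ ∧ ⌊ s ≟ᵥ g ⌋) ∧ q (true ∷ s))
                   ≡ # (λ s → ⌊ s ≟ᵥ g ⌋ ∧ q (b ∷ s))
  onlyHead false = trans (cong (# (λ s → ⌊ s ≟ᵥ g ⌋ ∧ q (false ∷ s)) +_) (countᵇ-false G)) (+-identityʳ _)
  onlyHead true = cong (_+ # (λ s → ⌊ s ≟ᵥ g ⌋ ∧ q (true ∷ s))) (countᵇ-false G)

#-singleton : ∀ {t} (q : Z2^ t → Bool) (g : Z2^ t) → # (λ s → ⌊ s ≟ᵥ g ⌋ ∧ q s) ≡ countᵇ q (g ∷ [])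
#-singleton q [] = countᵇ-cong {p = λ s → ⌊ s ≟ᵥ [] ⌋ ∧ q s} {q = q} (λ { [] → refl }) (allZ2^ 0)
#-singleton q (b ∷ g) = begin
  # (λ s → ⌊ s ≟ᵥ (b ∷ g) ⌋ ∧ q s)   ≡⟨ #-≟ᵥ∷ q b g ⟩
  # (λ s → ⌊ s ≟ᵥ g ⌋ ∧ q (b ∷ s))   ≡⟨ #-singleton (λ s → q (b ∷ s)) g ⟩
  countᵇ (λ s → q (b ∷ s)) (g ∷ [])  ≡⟨ countᵇ-map q (b ∷_) (g ∷ []) ⟨
  countᵇ q ((b ∷ g) ∷ [])            ∎
  where open ≡-Reasoning

#-∈ᵇ-∧ : ∀ {t} (q : Z2^ t → Bool) {S : List (Z2^ t)} → Unique S →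
         # (λ s → s ∈ᵇ S ∧ q s) ≡ countᵇ q S
#-∈ᵇ-∧ {t} q {[]} [] = countᵇ-false (allZ2^ t)
#-∈ᵇ-∧ q {g ∷ S} (g∉S ∷ S-unique) = begin
  # (λ s → s ∈ᵇ (g ∷ S) ∧ q s)                           ≡⟨ countᵇ-cong split (allZ2^ _) ⟩
  # (λ s → (⌊ s ≟ᵥ g ⌋ ∧ q s) ∨ (s ∈ᵇ S ∧ q s))           ≡⟨ countᵇ-∨ disjoint (allZ2^ _) ⟩
  # (λ s → ⌊ s ≟ᵥ g ⌋ ∧ q s) + # (λ s → s ∈ᵇ S ∧ q s)    ≡⟨ cong₂ _+_ (#-singleton q g) (#-∈ᵇ-∧ q S-unique) ⟩
  countᵇ q (g ∷ []) + countᵇ q S                         ≡⟨ countᵇ-++ q (g ∷ []) S ⟨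
  countᵇ q (g ∷ S)                                       ∎
  where
  open ≡-Reasoning
  g∈ᵇS≡false : g ∈ᵇ S ≡ false
  g∈ᵇS≡false = ∉⇒∈ᵇ≡false (All¬⇒¬Any g∉S)
  split : ∀ s → s ∈ᵇ (g ∷ S) ∧ q s ≡ (⌊ s ≟ᵥ g ⌋ ∧ q s) ∨ (s ∈ᵇ S ∧ q s)
  split s with s ≟ᵥ g
  ... | no _     = refl
  ... | yes refl rewrite g∈ᵇS≡false = sym (∨-identityʳ (q s))
  disjoint : ∀ s → ⌊ s ≟ᵥ g ⌋ ∧ q s ≡ true → s ∈ᵇ S ∧ q s ≡ false
  disjoint s with s ≟ᵥ g
  ... | no _ = λ ()
  ... | yes refl rewrite g∈ᵇS≡false = λ _ → refl

nbrs-translate : ∀ {t} (S : List (Z2^ t)) (q : Z2^ t → Bool) (x : Z2^ t) →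
                 # (λ y → CayAdj S x y ∧ q y) ≡ # (λ s → s ∈ᵇ S ∧ q (x ⊕ s))
nbrs-translate S q x = trans (sym (#-translate (λ y → CayAdj S x y ∧ q y) x))
  (countᵇ-cong (λ s → cong (λ z → z ∈ᵇ S ∧ q (x ⊕ s)) ([x⊕y]⊕x≡y x s)) (allZ2^ _))

record IsSubgroup {t} (K : Z2^ t → Bool) : Set where
  field
    0ᵥ∈ : K 0ᵥ ≡ true
    ⊕-closed : ∀ {x y} → K x ≡ true → K y ≡ true → K (x ⊕ y) ≡ true

  ⊕-invariant : ∀ {s} x → K s ≡ true → K (x ⊕ s) ≡ K x
  ⊕-invariant {s} x Ks with K x in Kx | K (x ⊕ s) in Kxs
  ... | true  | true  = refl
  ... | false | false = refl
  ... | true  | false = trans (sym Kxs) (⊕-closed Kx Ks)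
  ... | false | true  = trans (sym (subst (λ z → K z ≡ true) ([x⊕y]⊕y≡x x s) (⊕-closed Kxs Ks))) Kx

subgroup-isInternalPartition : ∀ {t} {S : List (Z2^ t)} {K : Z2^ t → Bool} {w : Z2^ t} →
  Unique S → IsSubgroup K → K w ≡ false →
  countᵇ (λ s → not (K s)) S ≤ countᵇ K S → IsInternalPartition S K
subgroup-isInternalPartition {S = S} {K} {w} S-unique K-subgroup Kw≡false minority =
  (0ᵥ , 0ᵥ∈) , (w , Kw≡false) , λ x → begin
    otherNbrs S K x                                 ≡⟨ nbrs-translate S _ x ⟩
    # (λ s → s ∈ᵇ S ∧ not ⌊ K (x ⊕ s) ≟B K x ⌋)     ≤⟨ countᵇ-mono (leaves x) (allZ2^ _) ⟩
    # (λ s → s ∈ᵇ S ∧ not (K s))                    ≡⟨ #-∈ᵇ-∧ _ S-unique ⟩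
    countᵇ (λ s → not (K s)) S                      ≤⟨ minority ⟩
    countᵇ K S                                      ≡⟨ #-∈ᵇ-∧ K S-unique ⟨
    # (λ s → s ∈ᵇ S ∧ K s)                          ≤⟨ countᵇ-mono (stays x) (allZ2^ _) ⟩
    # (λ s → s ∈ᵇ S ∧ ⌊ K (x ⊕ s) ≟B K x ⌋)         ≡⟨ nbrs-translate S _ x ⟨
    ownNbrs S K x                                   ∎
  where
  open IsSubgroup K-subgroup
  open ≤-Reasoning
  sameClass : ∀ x {s} → K s ≡ true → ⌊ K (x ⊕ s) ≟B K x ⌋ ≡ true
  sameClass x Ks = trans (isYes≗does _) (dec-true (K (x ⊕ _) ≟B K x) (⊕-invariant x Ks))
  stays : ∀ x s → s ∈ᵇ S ∧ K s ≡ true → s ∈ᵇ S ∧ ⌊ K (x ⊕ s) ≟B K x ⌋ ≡ true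
  stays x s with s ∈ᵇ S | K s in Ks
  ... | false | _     = λ ()
  ... | true  | false = λ ()
  ... | true  | true  = λ _ → sameClass x Ks
  leaves : ∀ x s → s ∈ᵇ S ∧ not ⌊ K (x ⊕ s) ≟B K x ⌋ ≡ true → s ∈ᵇ S ∧ not (K s) ≡ true
  leaves x s with s ∈ᵇ S | K s in Ks
  ... | false | _     = λ ()
  ... | true  | false = λ _ → refl
  ... | true  | true rewrite sameClass x Ks = λ ()

length≤countᵇ : ∀ {t} {S T : List (Z2^ t)} {K : Z2^ t → Bool} → Unique S → Unique T →
  All (_∈ S) T → All (λ s → K s ≡ true) T → length T ≤ countᵇ K S
length≤countᵇ {S = S} {T} {K} S-unique T-unique T⊆S K-on-T = begin
  length T                    ≡⟨ countᵇ-true T ⟨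
  countᵇ (λ _ → true) T       ≡⟨ #-∈ᵇ-∧ _ T-unique ⟨
  # (λ s → s ∈ᵇ T ∧ true)     ≤⟨ countᵇ-mono in-S-∩-K (allZ2^ _) ⟩
  # (λ s → s ∈ᵇ S ∧ K s)      ≡⟨ #-∈ᵇ-∧ K S-unique ⟩
  countᵇ K S                  ∎
  where
  open ≤-Reasoning
  in-S-∩-K : ∀ s → s ∈ᵇ T ∧ true ≡ true → s ∈ᵇ S ∧ K s ≡ true
  in-S-∩-K s with s ∈ᵇ T in s∈ᵇT
  ... | false = λ ()
  ... | true rewrite ∈⇒∈ᵇ (lookup T⊆S (∈ᵇ⇒∈ T s∈ᵇT)) = λ _ → lookup K-on-T (∈ᵇ⇒∈ T s∈ᵇT)

subgroupMajority⇒internalPartition : ∀ {t} {S T : List (Z2^ t)} {K : Z2^ t → Bool} {w : Z2^ t} →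
  Unique S → IsSubgroup K → K w ≡ false →
  Unique T → All (_∈ S) T → All (λ s → K s ≡ true) T → length S ≤ length T + length T →
  HasInternalPartition S
subgroupMajority⇒internalPartition {S = S} {T} {K} S-unique K-subgroup Kw≡false T-unique T⊆S K-on-T |S|≤2|T| =
  K , subgroup-isInternalPartition S-unique K-subgroup Kw≡false
        (+-cancelʳ-≤ (countᵇ K S) _ _ (begin
          countᵇ (λ s → not (K s)) S + countᵇ K S  ≡⟨ countᵇ-not K S ⟩
          length S                                 ≤⟨ |S|≤2|T| ⟩
          length T + length T                      ≤⟨ +-mono-≤ |T|≤|S∩K| |T|≤|S∩K| ⟩
          countᵇ K S + countᵇ K S                  ∎))
  where
  open ≤-Reasoning
  |T|≤|S∩K| : length T ≤ countᵇ K S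
  |T|≤|S∩K| = length≤countᵇ S-unique T-unique T⊆S K-on-T

span : ∀ {t} → List (Z2^ t) → List (Z2^ t)
span [] = 0ᵥ ∷ []
span (g ∷ gs) = span gs ++ map (g ⊕_) (span gs)

module _ {t : ℕ} where

  0ᵥ∈span : (gs : List (Z2^ t)) → 0ᵥ ∈ span gs
  0ᵥ∈span [] = here refl
  0ᵥ∈span (g ∷ gs) = ∈-++⁺ˡ (0ᵥ∈span gs)

  span-∷⁻ : ∀ {g x} (gs : List (Z2^ t)) → x ∈ span (g ∷ gs) → x ∈ span gs ⊎ g ⊕ x ∈ span gs
  span-∷⁻ {g} gs x∈ with ∈-++⁻ (span gs) x∈
  ... | inj₁ x∈′ = inj₁ x∈′
  ... | inj₂ x∈′ with ∈-map⁻ (g ⊕_) x∈′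
  ...   | y , y∈ , refl = inj₂ (subst (_∈ span gs) (sym (x⊕[x⊕y]≡y g y)) y∈)

  span-∷⁺ : ∀ {g x} (gs : List (Z2^ t)) → x ∈ span gs ⊎ g ⊕ x ∈ span gs → x ∈ span (g ∷ gs)
  span-∷⁺ gs (inj₁ x∈) = ∈-++⁺ˡ x∈
  span-∷⁺ {g} {x} gs (inj₂ g⊕x∈) =
    subst (_∈ span (g ∷ gs)) (x⊕[x⊕y]≡y g x) (∈-++⁺ʳ (span gs) (∈-map⁺ (g ⊕_) g⊕x∈))

  ∈⇒∈span : ∀ {g} {gs : List (Z2^ t)} → g ∈ gs → g ∈ span gs
  ∈⇒∈span {g} {gs = _ ∷ gs} (here refl) =
    span-∷⁺ gs (inj₂ (subst (_∈ span gs) (sym (⊕-self g)) (0ᵥ∈span gs)))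
  ∈⇒∈span {gs = _ ∷ gs} (there g∈) = span-∷⁺ gs (inj₁ (∈⇒∈span g∈))

  span-⊕-closed : ∀ (gs : List (Z2^ t)) {x y} → x ∈ span gs → y ∈ span gs → x ⊕ y ∈ span gs
  span-⊕-closed [] (here refl) (here refl) = here (⊕-self 0ᵥ)
  span-⊕-closed (g ∷ gs) {x} {y} x∈ y∈ = span-∷⁺ gs (combine (span-∷⁻ gs x∈) (span-∷⁻ gs y∈))
    where
    closed : ∀ {x y} → x ∈ span gs → y ∈ span gs → x ⊕ y ∈ span gs
    closed = span-⊕-closed gs
    combine : x ∈ span gs ⊎ g ⊕ x ∈ span gs → y ∈ span gs ⊎ g ⊕ y ∈ span gs →
              x ⊕ y ∈ span gs ⊎ g ⊕ (x ⊕ y) ∈ span gs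
    combine (inj₁ x∈′) (inj₁ y∈′) = inj₁ (closed x∈′ y∈′)
    combine (inj₁ x∈′) (inj₂ y∈′) = inj₂ (subst (_∈ span gs) (x⊕[y⊕z]≡y⊕[x⊕z] x g y) (closed x∈′ y∈′))
    combine (inj₂ x∈′) (inj₁ y∈′) = inj₂ (subst (_∈ span gs) (⊕-assoc g x y) (closed x∈′ y∈′))
    combine (inj₂ x∈′) (inj₂ y∈′) = inj₁ (subst (_∈ span gs) ([x⊕y]⊕[x⊕z]≡y⊕z g x y) (closed x∈′ y∈′))

  span-isSubgroup : (gs : List (Z2^ t)) → IsSubgroup (_∈ᵇ span gs)
  span-isSubgroup gs = record
    { 0ᵥ∈ = ∈⇒∈ᵇ (0ᵥ∈span gs)
    ; ⊕-closed = λ x∈ y∈ → ∈⇒∈ᵇ (span-⊕-closed gs (∈ᵇ⇒∈ (span gs) x∈) (∈ᵇ⇒∈ (span gs) y∈))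
    }

  ∉span₂ : ∀ {a b u : Z2^ t} → u ≢ 0ᵥ → u ≢ a → u ≢ b → u ≢ a ⊕ b → u ∉ span (a ∷ b ∷ [])
  ∉span₂ u≢0 _ _ _ (here u≡0) = u≢0 u≡0
  ∉span₂ {b = b} _ _ u≢b _ (there (here u≡b)) = u≢b (trans u≡b (⊕-identityʳ b))
  ∉span₂ {a = a} _ u≢a _ _ (there (there (here u≡a))) = u≢a (trans u≡a (⊕-identityʳ a))
  ∉span₂ {a = a} {b} _ _ _ u≢a⊕b (there (there (there (here u≡a⊕b)))) =
    u≢a⊕b (trans u≡a⊕b (cong (a ⊕_) (⊕-identityʳ b)))

  span₃-classify : ∀ {a b c g : Z2^ t} → g ∈ span (a ∷ b ∷ c ∷ []) →
    g ≢ 0ᵥ → g ≢ a → g ≢ b → g ≢ c → g ≡ a ⊕ b ⊎ g ≡ a ⊕ c ⊎ g ≡ b ⊕ c ⊎ g ≡ a ⊕ (b ⊕ c)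
  span₃-classify (here g≡0) g≢0 _ _ _ = ⊥-elim (g≢0 g≡0)
  span₃-classify {c = c} (there (here g≡c)) _ _ _ g≢c = ⊥-elim (g≢c (trans g≡c (⊕-identityʳ c)))
  span₃-classify {b = b} (there (there (here g≡b))) _ _ g≢b _ = ⊥-elim (g≢b (trans g≡b (⊕-identityʳ b)))
  span₃-classify {b = b} {c} (there (there (there (here g≡b⊕c)))) _ _ _ _ =
    inj₂ (inj₂ (inj₁ (trans g≡b⊕c (cong (b ⊕_) (⊕-identityʳ c)))))
  span₃-classify {a = a} (there (there (there (there (here g≡a))))) _ g≢a _ _ =
    ⊥-elim (g≢a (trans g≡a (⊕-identityʳ a)))
  span₃-classify {a = a} {c = c} (there (there (there (there (there (here g≡a⊕c)))))) _ _ _ _ =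
    inj₂ (inj₁ (trans g≡a⊕c (cong (a ⊕_) (⊕-identityʳ c))))
  span₃-classify {a = a} {b} (there (there (there (there (there (there (here g≡a⊕b))))))) _ _ _ _ =
    inj₁ (trans g≡a⊕b (cong (a ⊕_) (⊕-identityʳ b)))
  span₃-classify {a = a} {b} {c} (there (there (there (there (there (there (there (here g≡Σ)))))))) _ _ _ _ =
    inj₂ (inj₂ (inj₂ (trans g≡Σ (cong (λ z → a ⊕ (b ⊕ z)) (⊕-identityʳ c)))))

pairSum-internalPartition : ∀ {t} {S : List (Z2^ t)} {a b c u : Z2^ t} →
  Unique S → length S ≤ 6 → a ∈ S → b ∈ S → c ∈ S → c ≡ a ⊕ b → a ≢ b → c ≢ a → c ≢ b →
  u ≢ 0ᵥ → u ≢ a → u ≢ b → u ≢ c → HasInternalPartition S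
pairSum-internalPartition {a = a} {b} {c} {u} S-unique |S|≤6 a∈S b∈S c∈S c≡a⊕b a≢b c≢a c≢b u≢0 u≢a u≢b u≢c =
  subgroupMajority⇒internalPartition {w = u} S-unique (span-isSubgroup (a ∷ b ∷ [])) (∉⇒∈ᵇ≡false u∉K)
    ((a≢b ∷ ≢-sym c≢a ∷ []) ∷ (≢-sym c≢b ∷ []) ∷ [] ∷ [])
    (a∈S ∷ b∈S ∷ c∈S ∷ [])
    (a∈K ∷ b∈K ∷ subst (λ z → z ∈ᵇ K ≡ true) (sym c≡a⊕b) (⊕-closed {a} {b} a∈K b∈K) ∷ [])
    |S|≤6
  where
  K : List (Z2^ _)
  K = span (a ∷ b ∷ [])
  open IsSubgroup (span-isSubgroup (a ∷ b ∷ []))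
  a∈K : a ∈ᵇ K ≡ true
  a∈K = ∈⇒∈ᵇ (∈⇒∈span {gs = a ∷ b ∷ []} (here refl))
  b∈K : b ∈ᵇ K ≡ true
  b∈K = ∈⇒∈ᵇ (∈⇒∈span {gs = a ∷ b ∷ []} (there (here refl)))
  u∉K : u ∉ K
  u∉K = ∉span₂ u≢0 u≢a u≢b (subst (u ≢_) c≡a⊕b u≢c)

fiveElements-internalPartition : ∀ {t} {g₁ g₂ g₃ g₄ g₅ : Z2^ t} →
  Unique (g₁ ∷ g₂ ∷ g₃ ∷ g₄ ∷ g₅ ∷ []) → All (_≢ 0ᵥ) (g₁ ∷ g₂ ∷ g₃ ∷ g₄ ∷ g₅ ∷ []) →
  HasInternalPartition (g₁ ∷ g₂ ∷ g₃ ∷ g₄ ∷ g₅ ∷ [])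
fiveElements-internalPartition {g₁ = g₁} {g₂} {g₃} {g₄} {g₅}
  S-unique@((n₁₂ ∷ n₁₃ ∷ n₁₄ ∷ n₁₅ ∷ []) ∷ (n₂₃ ∷ n₂₄ ∷ n₂₅ ∷ []) ∷ (n₃₄ ∷ n₃₅ ∷ []) ∷ (n₄₅ ∷ []) ∷ [] ∷ [])
  (n₁ ∷ n₂ ∷ n₃ ∷ n₄ ∷ n₅ ∷ []) = cases (any? (g₄ ≟ᵥ_) H) (any? (g₅ ≟ᵥ_) H)
  where
  S H : List (Z2^ _)
  S = g₁ ∷ g₂ ∷ g₃ ∷ g₄ ∷ g₅ ∷ []
  H = span (g₁ ∷ g₂ ∷ g₃ ∷ [])

  g₁∈S : g₁ ∈ S
  g₁∈S = here refl
  g₂∈S : g₂ ∈ S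
  g₂∈S = there (here refl)
  g₃∈S : g₃ ∈ S
  g₃∈S = there (there (here refl))
  g₄∈S : g₄ ∈ S
  g₄∈S = there (there (there (here refl)))
  g₅∈S : g₅ ∈ S
  g₅∈S = there (there (there (there (here refl))))

  outside : ∀ {w} → w ∉ H → HasInternalPartition S
  outside {w} w∉H =
    subgroupMajority⇒internalPartition {w = w} S-unique (span-isSubgroup (g₁ ∷ g₂ ∷ g₃ ∷ [])) (∉⇒∈ᵇ≡false w∉H)
      ((n₁₂ ∷ n₁₃ ∷ []) ∷ (n₂₃ ∷ []) ∷ [] ∷ [])
      (g₁∈S ∷ g₂∈S ∷ g₃∈S ∷ [])
      (generator (here refl) ∷ generator (there (here refl)) ∷ generator (there (there (here refl))) ∷ [])
      (n≤1+n 5)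
    where
    generator : ∀ {g} → g ∈ g₁ ∷ g₂ ∷ g₃ ∷ [] → g ∈ᵇ H ≡ true
    generator = ∈⇒∈ᵇ ∘ ∈⇒∈span

  pairCase : ∀ {c} → c ∈ S → c ∈ H → c ≢ 0ᵥ → c ≢ g₁ → c ≢ g₂ → c ≢ g₃ → c ≢ g₁ ⊕ (g₂ ⊕ g₃) →
             HasInternalPartition S
  pairCase c∈S c∈H c≢0 c≢g₁ c≢g₂ c≢g₃ c≢Σ with span₃-classify c∈H c≢0 c≢g₁ c≢g₂ c≢g₃
  ... | inj₁ c≡g₁⊕g₂ = pairSum-internalPartition S-unique (n≤1+n 5) g₁∈S g₂∈S c∈S c≡g₁⊕g₂
        n₁₂ c≢g₁ c≢g₂ n₃ (≢-sym n₁₃) (≢-sym n₂₃) (≢-sym c≢g₃)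
  ... | inj₂ (inj₁ c≡g₁⊕g₃) = pairSum-internalPartition S-unique (n≤1+n 5) g₁∈S g₃∈S c∈S c≡g₁⊕g₃
        n₁₃ c≢g₁ c≢g₃ n₂ (≢-sym n₁₂) n₂₃ (≢-sym c≢g₂)
  ... | inj₂ (inj₂ (inj₁ c≡g₂⊕g₃)) = pairSum-internalPartition S-unique (n≤1+n 5) g₂∈S g₃∈S c∈S c≡g₂⊕g₃
        n₂₃ c≢g₂ c≢g₃ n₁ n₁₂ n₁₃ (≢-sym c≢g₁)
  ... | inj₂ (inj₂ (inj₂ c≡Σ)) = ⊥-elim (c≢Σ c≡Σ)

  cases : Dec (g₄ ∈ H) → Dec (g₅ ∈ H) → HasInternalPartition S
  cases (no g₄∉H) _ = outside g₄∉H
  cases (yes _) (no g₅∉H) = outside g₅∉H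
  cases (yes g₄∈H) (yes g₅∈H) with g₄ ≟ᵥ (g₁ ⊕ (g₂ ⊕ g₃))
  ... | no g₄≢Σ = pairCase g₄∈S g₄∈H n₄ (≢-sym n₁₄) (≢-sym n₂₄) (≢-sym n₃₄) g₄≢Σ
  ... | yes g₄≡Σ = pairCase g₅∈S g₅∈H n₅ (≢-sym n₁₅) (≢-sym n₂₅) (≢-sym n₃₅)
                     (λ g₅≡Σ → n₄₅ (trans g₄≡Σ (sym g₅≡Σ)))

mainTheorem13 : (t : ℕ) → t ≥ 1 → (g₁ g₂ g₃ g₄ g₅ : Z2^ t) →
    g₁ ≢ 0ᵥ → g₂ ≢ 0ᵥ → g₃ ≢ 0ᵥ → g₄ ≢ 0ᵥ → g₅ ≢ 0ᵥ →
    g₁ ≢ g₂ → g₁ ≢ g₃ → g₁ ≢ g₄ → g₁ ≢ g₅ →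
    g₂ ≢ g₃ → g₂ ≢ g₄ → g₂ ≢ g₅ →
    g₃ ≢ g₄ → g₃ ≢ g₅ →
    g₄ ≢ g₅ →
    HasInternalPartition (g₁ ∷ g₂ ∷ g₃ ∷ g₄ ∷ g₅ ∷ [])
mainTheorem13 t _ g₁ g₂ g₃ g₄ g₅ n₁ n₂ n₃ n₄ n₅ n₁₂ n₁₃ n₁₄ n₁₅ n₂₃ n₂₄ n₂₅ n₃₄ n₃₅ n₄₅ =
  fiveElements-internalPartition
    ((n₁₂ ∷ n₁₃ ∷ n₁₄ ∷ n₁₅ ∷ []) ∷ (n₂₃ ∷ n₂₄ ∷ n₂₅ ∷ []) ∷ (n₃₄ ∷ n₃₅ ∷ []) ∷ (n₄₅ ∷ []) ∷ [] ∷ [])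
    (n₁ ∷ n₂ ∷ n₃ ∷ n₄ ∷ n₅ ∷ [])
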